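{- For $n\ge1$, let $\mathrm{id}_n=12\cdots n$ and $\overline{\mathrm{id}}_n=n\cdots21$. Then the equivalence classes of $\mathrm{id}_n$ and of $\overline{\mathrm{id}}_n$ under $\sim$ both have exactly $F_{n+1}$ elements.
   Context: Two permutations $u,v\in\mathfrak{S}_n$ (written as words $a_1\cdots a_n$) are equivalent, $u\sim v$, if $v$ can be obtained from $u$ by a sequence of interchanges of two adjacent entries $a_i,a_{i+1}$ with $|a_i-a_{i+1}|=1$. $F_m$ denotes the Fibonacci numbers: $F_1=F_2=1$, $F_m=F_{m-1}+F_{m-2}$. -}

module Defs where

open import Data.Nat using (ℕ; zero; suc; _+_)
open import Data.List using (List; []; _∷_; _++_; applyUpTo; applyDownFrom; length)
open import Data.List.Membership.Propositional using (_∈_)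
open import Data.List.Relation.Unary.Unique.Propositional using (Unique)
open import Data.List.Relation.Binary.Permutation.Propositional using (_↭_)
open import Data.Product using (Σ; _×_)
open import Data.Sum using (_⊎_)
open import Function.Bundles using (_⇔_)
open import Relation.Binary.Construct.Closure.ReflexiveTransitive using (Star)
open import Relation.Binary.PropositionalEquality using (_≡_)

F : ℕ → ℕ
F zero = 0
F (suc zero) = 1
F (suc (suc m)) = F (suc m) + F m

-- Permutations of [n] = {1,…,n} in one-line notation a₁ ⋯ aₙ, as words (lists).
-- A word is a permutation in 𝔖ₙ iff it is a rearrangement of 1 2 ⋯ n.
idWord : ℕ → List ℕ
idWord n = applyUpTo suc n

revIdWord : ℕ → List ℕ
revIdWord n = applyDownFrom suc n

IsPerm : ℕ → List ℕ → Set
IsPerm n w = w ↭ idWord n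

Consecutive : ℕ → ℕ → Set
Consecutive a b = (suc a ≡ b) ⊎ (suc b ≡ a)

data Step : List ℕ → List ℕ → Set where
  swap : ∀ (xs ys : List ℕ) (a b : ℕ) → Consecutive a b →
         Step (xs ++ a ∷ b ∷ ys) (xs ++ b ∷ a ∷ ys)

_∼_ : List ℕ → List ℕ → Set
u ∼ v = Star Step u v

ClassSize : ℕ → List ℕ → ℕ → Set
ClassSize n u k =
  Σ (List (List ℕ)) λ c →
    Unique c × length c ≡ k × (∀ v → (v ∈ c) ⇔ (IsPerm n v × u ∼ v))

module Submission where

-- The class of 1 2 ⋯ n consists of the words made, left to right, of blocks
-- "i" (squares) and "i+1 i" (dominoes), each block using the next unused
-- letters.  Each such word is reached from 1 2 ⋯ n by flipping its dominoes;
-- conversely a move can only turn two adjacent squares into a domino or back,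
-- because next to a domino there is no letter differing by 1 from its
-- neighbour.  These words are the square/domino tilings of a strip of length
-- n, so there are F (n + 1) of them.  Reversal maps moves to moves and
-- 1 2 ⋯ n to n ⋯ 2 1, so the second class has the same size.

open import Defs
open import Data.Empty using (⊥)
open import Data.Nat using (ℕ; zero; suc; _+_; _≥_)
open import Data.Nat.Properties using (+-identityʳ; +-suc)
open import Data.Product using (_×_; _,_)
open import Data.Sum using (inj₁; inj₂)
open import Data.List
  using (List; []; _∷_; _++_; applyUpTo; length; map; reverse)
open import Data.List.Properties
  using ( length-++; length-map; length-applyUpTo; ∷-injectiveʳ; ++-assoc
        ; reverse-++; reverse-involutive; reverse-injective; reverse-applyUpTo)
open import Data.List.Membership.Propositional using (_∈_)
open import Data.List.Membership.Propositional.Properties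
  using (∈-map⁺; ∈-map⁻; ∈-++⁺ˡ; ∈-++⁺ʳ; ∈-++⁻)
open import Data.List.Relation.Unary.Any using (here)
open import Data.List.Relation.Unary.All using ([])
open import Data.List.Relation.Unary.AllPairs using ([]; _∷_)
open import Data.List.Relation.Unary.Unique.Propositional using (Unique)
import Data.List.Relation.Unary.Unique.Propositional.Properties as Unique
open import Data.List.Relation.Binary.Permutation.Propositional
  using (_↭_; prep; swap; ↭-refl; ↭-trans)
open import Data.List.Relation.Binary.Permutation.Propositional.Properties
  using (↭-length; ↭-reverse)
open import Relation.Binary.Construct.Closure.ReflexiveTransitive
  using (ε; _◅_; gmap)
open import Relation.Binary.PropositionalEquality
  using (_≡_; refl; sym; trans; cong; cong₂; subst; subst₂; module ≡-Reasoning)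
open import Function.Base using (_∘_)
open import Function.Bundles using (_⇔_; mk⇔; Equivalence)
open import Function.Properties.Equivalence using () renaming (trans to ⇔-trans; sym to ⇔-sym)

data Tiling : ℕ → List ℕ → Set where
  done   : ∀ {k} → Tiling k []
  square : ∀ {k w} → Tiling (suc k) w → Tiling k (suc k ∷ w)
  domino : ∀ {k w} → Tiling (suc (suc k)) w → Tiling k (suc (suc k) ∷ suc k ∷ w)

swap-preserves-Tiling : ∀ {k} xs {ys a b} → Consecutive a b →
  Tiling k (xs ++ a ∷ b ∷ ys) → Tiling k (xs ++ b ∷ a ∷ ys)
swap-preserves-Tiling []           _           (square (square t)) = domino t
swap-preserves-Tiling []           (inj₁ ())   (square (domino _))
swap-preserves-Tiling []           (inj₂ ())   (square (domino _))
swap-preserves-Tiling []           _           (domino t)          = square (square t)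
swap-preserves-Tiling (_ ∷ [])     c           (square t)          = square (swap-preserves-Tiling [] c t)
swap-preserves-Tiling (_ ∷ [])     (inj₁ refl) (domino ())
swap-preserves-Tiling (_ ∷ [])     (inj₂ refl) (domino ())
swap-preserves-Tiling (_ ∷ y ∷ xs) c           (square t)          = square (swap-preserves-Tiling (y ∷ xs) c t)
swap-preserves-Tiling (_ ∷ _ ∷ xs) c           (domino t)          = domino (swap-preserves-Tiling xs c t)

∼-preserves-Tiling : ∀ {k u v} → u ∼ v → Tiling k u → Tiling k v
∼-preserves-Tiling ε                     t = t
∼-preserves-Tiling (swap xs _ _ _ c ◅ s) t = ∼-preserves-Tiling s (swap-preserves-Tiling xs c t)

ascending : ℕ → ℕ → List ℕ
ascending k zero    = []
ascending k (suc m) = suc k ∷ ascending (suc k) m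

applyUpTo≡ascending : ∀ (f : ℕ → ℕ) k m → (∀ i → f i ≡ suc (k + i)) →
  applyUpTo f m ≡ ascending k m
applyUpTo≡ascending f k zero    f≗ = refl
applyUpTo≡ascending f k (suc m) f≗ = cong₂ _∷_
  (trans (f≗ 0) (cong suc (+-identityʳ k)))
  (applyUpTo≡ascending (λ i → f (suc i)) (suc k) m (λ i → trans (f≗ (suc i)) (cong suc (+-suc k i))))

idWord≡ascending : ∀ n → idWord n ≡ ascending 0 n
idWord≡ascending n = applyUpTo≡ascending suc 0 n (λ _ → refl)

ascending-Tiling : ∀ k m → Tiling k (ascending k m)
ascending-Tiling k zero    = done
ascending-Tiling k (suc m) = square (ascending-Tiling (suc k) m)

∼-cons : ∀ x {u v} → u ∼ v → (x ∷ u) ∼ (x ∷ v)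
∼-cons x = gmap (x ∷_) λ { (swap xs ys a b c) → swap (x ∷ xs) ys a b c }

ascending∼Tiling : ∀ {k w} → Tiling k w → ascending k (length w) ∼ w
ascending∼Tiling done       = ε
ascending∼Tiling (square t) = ∼-cons _ (ascending∼Tiling t)
ascending∼Tiling {k} (domino t) =
  swap [] _ (suc k) (suc (suc k)) (inj₁ refl) ◅ ∼-cons _ (∼-cons _ (ascending∼Tiling t))

Tiling↭ascending : ∀ {k w} → Tiling k w → w ↭ ascending k (length w)
Tiling↭ascending done       = ↭-refl
Tiling↭ascending (square t) = prep _ (Tiling↭ascending t)
Tiling↭ascending (domino t) = swap _ _ (Tiling↭ascending t)

class-of-idWord : ∀ n v → (IsPerm n v × idWord n ∼ v) ⇔ (Tiling 0 v × length v ≡ n)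
class-of-idWord n v = mk⇔ to from
  where
  to : IsPerm n v × idWord n ∼ v → Tiling 0 v × length v ≡ n
  to (v↭ , id∼v) =
      ∼-preserves-Tiling id∼v (subst (Tiling 0) (sym (idWord≡ascending n)) (ascending-Tiling 0 n))
    , trans (↭-length v↭) (length-applyUpTo suc n)
  from : Tiling 0 v × length v ≡ n → IsPerm n v × idWord n ∼ v
  from (t , refl) rewrite idWord≡ascending (length v) = Tiling↭ascending t , ascending∼Tiling t

tilings : ℕ → ℕ → List (List ℕ)
tilings k zero          = [] ∷ []
tilings k (suc zero)    = (suc k ∷ []) ∷ []
tilings k (suc (suc m)) =
  map (suc k ∷_) (tilings (suc k) (suc m)) ++
  map (λ w → suc (suc k) ∷ suc k ∷ w) (tilings (suc (suc k)) m)

length-tilings : ∀ k m → length (tilings k m) ≡ F (suc m)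
length-tilings k zero          = refl
length-tilings k (suc zero)    = refl
length-tilings k (suc (suc m)) = begin
  length (map (suc k ∷_) squares ++ map (λ w → suc (suc k) ∷ suc k ∷ w) dominoes)
    ≡⟨ length-++ (map (suc k ∷_) squares) ⟩
  length (map (suc k ∷_) squares) + length (map (λ w → suc (suc k) ∷ suc k ∷ w) dominoes)
    ≡⟨ cong₂ _+_ (length-map _ squares) (length-map _ dominoes) ⟩
  length squares + length dominoes
    ≡⟨ cong₂ _+_ (length-tilings (suc k) (suc m)) (length-tilings (suc (suc k)) m) ⟩
  F (suc (suc m)) + F (suc m)
    ∎
  where
  open ≡-Reasoning
  squares  = tilings (suc k) (suc m)
  dominoes = tilings (suc (suc k)) m

tilings-unique : ∀ k m → Unique (tilings k m)
tilings-unique k zero          = [] ∷ []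
tilings-unique k (suc zero)    = [] ∷ []
tilings-unique k (suc (suc m)) = Unique.++⁺
  (Unique.map⁺ ∷-injectiveʳ (tilings-unique (suc k) (suc m)))
  (Unique.map⁺ (λ e → ∷-injectiveʳ (∷-injectiveʳ e)) (tilings-unique (suc (suc k)) m))
  heads-differ
  where
  heads-differ : ∀ {v} → v ∈ map (suc k ∷_) (tilings (suc k) (suc m)) ×
                         v ∈ map (λ w → suc (suc k) ∷ suc k ∷ w) (tilings (suc (suc k)) m) →
                 ⊥
  heads-differ (p , q) with ∈-map⁻ _ p | ∈-map⁻ _ q
  ... | _ , _ , refl | _ , _ , ()

∈-tilings⁻ : ∀ k m {v} → v ∈ tilings k m → Tiling k v × length v ≡ m
∈-tilings⁻ k zero          (here refl) = done , refl
∈-tilings⁻ k (suc zero)    (here refl) = square done , refl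
∈-tilings⁻ k (suc (suc m)) p with ∈-++⁻ (map (suc k ∷_) (tilings (suc k) (suc m))) p
... | inj₁ q with ∈-map⁻ _ q
...   | _ , r , refl with t , |w|≡ ← ∈-tilings⁻ (suc k) (suc m) r = square t , cong suc |w|≡
∈-tilings⁻ k (suc (suc m)) p | inj₂ q with ∈-map⁻ _ q
...   | _ , r , refl with t , |w|≡ ← ∈-tilings⁻ (suc (suc k)) m r = domino t , cong (suc ∘ suc) |w|≡

∈-tilings⁺ : ∀ {k v} → Tiling k v → v ∈ tilings k (length v)
∈-tilings⁺ done                  = here refl
∈-tilings⁺ (square done)         = here refl
∈-tilings⁺ (square t@(square _)) = ∈-++⁺ˡ (∈-map⁺ _ (∈-tilings⁺ t))
∈-tilings⁺ (square t@(domino _)) = ∈-++⁺ˡ (∈-map⁺ _ (∈-tilings⁺ t))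
∈-tilings⁺ {k} (domino {w = w} t) =
  ∈-++⁺ʳ (map (suc k ∷_) (tilings (suc k) (suc (length w)))) (∈-map⁺ _ (∈-tilings⁺ t))

∈-tilings⇔ : ∀ k m v → v ∈ tilings k m ⇔ (Tiling k v × length v ≡ m)
∈-tilings⇔ k m v = mk⇔ (∈-tilings⁻ k m) λ { (t , refl) → ∈-tilings⁺ t }

classSize-idWord : ∀ n → ClassSize n (idWord n) (F (suc n))
classSize-idWord n =
  tilings 0 n , tilings-unique 0 n , length-tilings 0 n ,
  λ v → ⇔-trans (∈-tilings⇔ 0 n v) (⇔-sym (class-of-idWord n v))

reverse-middle : ∀ xs ys (a b : ℕ) → reverse (xs ++ a ∷ b ∷ ys) ≡ reverse ys ++ b ∷ a ∷ reverse xs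
reverse-middle xs ys a b = begin
  reverse (xs ++ a ∷ b ∷ ys)                 ≡⟨ reverse-++ xs (a ∷ b ∷ ys) ⟩
  reverse (a ∷ b ∷ ys) ++ reverse xs         ≡⟨ cong (_++ reverse xs) (reverse-++ (a ∷ b ∷ []) ys) ⟩
  (reverse ys ++ b ∷ a ∷ []) ++ reverse xs   ≡⟨ ++-assoc (reverse ys) (b ∷ a ∷ []) (reverse xs) ⟩
  reverse ys ++ b ∷ a ∷ reverse xs           ∎
  where open ≡-Reasoning

Step-reverse : ∀ {u v} → Step u v → Step (reverse u) (reverse v)
Step-reverse (swap xs ys a b c) =
  subst₂ Step (sym (reverse-middle xs ys a b)) (sym (reverse-middle xs ys b a))
    (swap (reverse ys) (reverse xs) b a (Consecutive-sym c))
  where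
  Consecutive-sym : ∀ {a b} → Consecutive a b → Consecutive b a
  Consecutive-sym (inj₁ e) = inj₂ e
  Consecutive-sym (inj₂ e) = inj₁ e

∼-reverse : ∀ {u v} → u ∼ v → reverse u ∼ reverse v
∼-reverse = gmap reverse Step-reverse

IsPerm-reverse : ∀ {n v} → IsPerm n v → IsPerm n (reverse v)
IsPerm-reverse {v = v} = ↭-trans (↭-reverse v)

ClassSize-reverse : ∀ {n u k} → ClassSize n u k → ClassSize n (reverse u) k
ClassSize-reverse {n} {u} (c , c-unique , |c|≡k , c≡class) =
  map reverse c , Unique.map⁺ reverse-injective c-unique , trans (length-map reverse c) |c|≡k ,
  λ v → mk⇔ (to v) (from v)
  where
  to : ∀ v → v ∈ map reverse c → IsPerm n v × reverse u ∼ v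
  to v p with w , w∈c , refl ← ∈-map⁻ reverse p
       with w-perm , u∼w ← Equivalence.to (c≡class w) w∈c
       = IsPerm-reverse w-perm , ∼-reverse u∼w
  from : ∀ v → IsPerm n v × reverse u ∼ v → v ∈ map reverse c
  from v (v-perm , ru∼v) =
    subst (_∈ map reverse c) (reverse-involutive v) (∈-map⁺ reverse
      (Equivalence.from (c≡class (reverse v))
        (IsPerm-reverse v-perm , subst (_∼ reverse v) (reverse-involutive u) (∼-reverse ru∼v))))

proposition2p6 : (n : ℕ) → n ≥ 1 →
    ClassSize n (idWord n) (F (suc n)) × ClassSize n (revIdWord n) (F (suc n))
proposition2p6 n _ =
    classSize-idWord n
  , subst (λ u → ClassSize n u (F (suc n))) (reverse-applyUpTo suc n)
      (ClassSize-reverse (classSize-idWord n))
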